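{- Let $n \geqslant 3$ and $k$ be integers with $\lfloor n/2 \rfloor \leqslant k < n-3$ and $n \not\equiv k \pmod 2$. Let $h = \frac{n-k-1}{2}$ and $p = \gcd(n,h)$. Then $$\mathrm{LB}(n,k) + \left\lceil \frac{p}{2} \right\rceil - 1 \leqslant rn_k(C_n),$$ where, with $\varPhi(n,k) = \left\lceil \frac{3k+3-n}{2}\right\rceil$, $\mathrm{LB}(n,k) = \varPhi(n,k)\frac{n-2}{2} + k - \frac{n}{2} + 1$ if $n$ is even and $\mathrm{LB}(n,k) = \varPhi(n,k)\frac{n-1}{2}$ if $n$ is odd.
   Context: $C_n$ is the cycle on vertex set $\mathbb{Z}_n$, with $u,v$ adjacent iff $u \equiv v \pm 1 \pmod n$; $d(u,v)$ is the graph distance. A radio-$k$-labeling of a graph $G$ is a function $f \colon V(G) \to \{0,1,2,\ldots\}$ with $|f(u)-f(v)| \geqslant k - d(u,v) + 1$ for all distinct $u,v$. The span of $f$ is $\max\{|f(u)-f(v)|\}$, and $rn_k(G)$ is the minimum span over radio-$k$-labelings of $G$. -}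

module Defs where

open import Data.Nat using (ℕ; _+_; _*_; _∸_; _⊓_; _⊔_; ∣_-_∣; _≤_; _/_; _%_)
open import Data.Fin using (Fin; toℕ)
open import Data.List using (List; foldr; map; concatMap; allFin)
open import Data.Nat.GCD using (gcd)
open import Relation.Binary.PropositionalEquality using (_≢_)

cycDist : (n : ℕ) → Fin n → Fin n → ℕ
cycDist n u v = ∣ toℕ u - toℕ v ∣ ⊓ (n ∸ ∣ toℕ u - toℕ v ∣)

-- radio-k-labeling of C_n : |f u - f v| ≥ k - d(u,v) + 1 for distinct u v
-- (written without subtraction: k + 1 ≤ |f u - f v| + d(u,v))
IsRadioLabeling : (n k : ℕ) → (Fin n → ℕ) → Set
IsRadioLabeling n k f =
  ∀ (u v : Fin n) → u ≢ v → k + 1 ≤ ∣ f u - f v ∣ + cycDist n u v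

span : (n : ℕ) → (Fin n → ℕ) → ℕ
span n f = foldr _⊔_ 0
  (concatMap (λ u → map (λ v → ∣ f u - f v ∣) (allFin n)) (allFin n))

-- "b ≤ rn_k(C_n)" : every radio-k-labeling of C_n has span at least b
RnLowerBound : (n k b : ℕ) → Set
RnLowerBound n k b = ∀ (f : Fin n → ℕ) → IsRadioLabeling n k f → b ≤ span n f

ceilHalf : ℕ → ℕ
ceilHalf a = (a + 1) / 2

-- Φ(n,k) = ⌈(3k+3-n)/2⌉   (3k+3-n > 0 under the hypotheses)
Φ : ℕ → ℕ → ℕ
Φ n k = ceilHalf (3 * k + 3 ∸ n)

-- LB(n,k); under the hypotheses all quantities are natural numbers
-- (n even: (n-2)/2 and n/2 exact, k ≥ n/2; n odd: (n-1)/2 exact)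
LB : ℕ → ℕ → ℕ
LB n k with n % 2
... | 0 = Φ n k * ((n ∸ 2) / 2) + k + 1 ∸ (n / 2)
... | _ = Φ n k * ((n ∸ 1) / 2)

-- h = (n-k-1)/2 (exact since n ≢ k mod 2), p = gcd(n,h)
hh : ℕ → ℕ → ℕ
hh n k = (n ∸ k ∸ 1) / 2

pp : ℕ → ℕ → ℕ
pp n k = gcd n (hh n k)

-- List the vertices in order of increasing label as x₀, x₁, …, x_{n−1}, and write n = k + 1 + 2h,
-- so that Φ(n,k) = k + 1 − h.  For three consecutive vertices the three radio conditions, together
-- with d(x_a,x_{a+1}) + d(x_{a+1},x_{a+2}) + d(x_a,x_{a+2}) ≤ n, give
-- f(x_{a+2}) − f(x_a) ≥ Φ + |d(x_a,x_{a+2}) − h|.  Summing over even a gives a span of at least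
-- LB(n,k) + V, where V = Σ_j |d(x_{2j},x_{2j+2}) − h|.  As p divides n and h, the difference
-- x_{2j+2} − x_{2j} of positions is congruent mod p to ±(d(x_{2j},x_{2j+2}) − h); so the residues
-- mod p of the positions x_{2j} follow an integer walk of total variation V and take at most V + 1
-- values.  The ⌈n/2⌉ distinct positions x_{2j} thus fit into (V + 1)·n/p places, forcing
-- ⌈p/2⌉ ≤ V + 1.
module Submission where

open import Defs

module Arithmetic where

  open import Data.Nat
  open import Data.Nat.DivMod using (m<n*o⇒m/o<n)
  open import Data.Nat.Properties
  open import Data.Nat.Tactic.RingSolver using (solve)
  open import Data.List using (_∷_; [])
  open import Data.Sum using (inj₁; inj₂)
  open import Relation.Binary.PropositionalEquality

  [n∸m]+[o∸n]≡o∸m : ∀ {m n o} → m ≤ n → n ≤ o → (n ∸ m) + (o ∸ n) ≡ o ∸ m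
  [n∸m]+[o∸n]≡o∸m {m} {n} {o} m≤n n≤o = begin
    (n ∸ m) + (o ∸ n) ≡⟨ +-comm (n ∸ m) _ ⟩
    (o ∸ n) + (n ∸ m) ≡⟨ +-∸-assoc (o ∸ n) m≤n ⟨
    (o ∸ n) + n ∸ m   ≡⟨ cong (_∸ m) (m∸n+n≡m n≤o) ⟩
    o ∸ m             ∎
    where open ≡-Reasoning

  two-gaps-far : ∀ {K h Ψ X Y d₁ d₂ e} → Ψ + h ≡ K →
    K ≤ X + d₁ → K ≤ Y + d₂ → d₁ + d₂ + (e + h) ≤ K + h + h → Ψ + e ≤ X + Y
  two-gaps-far {K} {h} {Ψ} {X} {Y} {d₁} {d₂} {e} Ψ+h≡K K≤X+d₁ K≤Y+d₂ perimeter≤ =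
    +-cancelʳ-≤ (K + h + h) _ _ (begin
      Ψ + e + (K + h + h)             ≡⟨ solve (Ψ ∷ e ∷ h ∷ K ∷ []) ⟩
      (Ψ + h) + K + (e + h)           ≡⟨ cong (λ a → a + K + (e + h)) Ψ+h≡K ⟩
      K + K + (e + h)                 ≤⟨ +-monoˡ-≤ (e + h) (+-mono-≤ K≤X+d₁ K≤Y+d₂) ⟩
      (X + d₁) + (Y + d₂) + (e + h)   ≡⟨ solve (X ∷ d₁ ∷ Y ∷ d₂ ∷ e ∷ h ∷ []) ⟩
      X + Y + (d₁ + d₂ + (e + h))     ≤⟨ +-monoʳ-≤ (X + Y) perimeter≤ ⟩
      X + Y + (K + h + h)             ∎)
    where open ≤-Reasoning

  -- X, Y: label gaps of three vertices in label order; d₁, d₂, d₃: their pairwise distances,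
  -- d₃ between the outer two; K + h + h: the length of the cycle.
  two-gaps≥ : ∀ {K h Ψ X Y d₁ d₂ d₃} → Ψ + h ≡ K →
    K ≤ X + d₁ → K ≤ Y + d₂ → K ≤ X + Y + d₃ → d₁ + d₂ + d₃ ≤ K + h + h →
    Ψ + ∣ d₃ - h ∣ ≤ X + Y
  two-gaps≥ {K} {h} {Ψ} {X} {Y} {d₁} {d₂} {d₃} Ψ+h≡K K≤X+d₁ K≤Y+d₂ K≤X+Y+d₃ perimeter≤
    with ≤-total d₃ h
  ... | inj₁ d₃≤h rewrite m≤n⇒∣m-n∣≡n∸m d₃≤h = +-cancelʳ-≤ d₃ _ _ (begin
    Ψ + (h ∸ d₃) + d₃ ≡⟨ +-assoc Ψ (h ∸ d₃) d₃ ⟩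
    Ψ + (h ∸ d₃ + d₃) ≡⟨ cong (Ψ +_) (m∸n+n≡m d₃≤h) ⟩
    Ψ + h             ≡⟨ Ψ+h≡K ⟩
    K                 ≤⟨ K≤X+Y+d₃ ⟩
    X + Y + d₃        ∎)
    where open ≤-Reasoning
  ... | inj₂ h≤d₃ rewrite m≤n⇒∣n-m∣≡n∸m h≤d₃ =
    two-gaps-far {X = X} {Y} {d₁} {d₂} Ψ+h≡K K≤X+d₁ K≤Y+d₂
      (subst (λ d → d₁ + d₂ + d ≤ K + h + h) (sym (m∸n+n≡m h≤d₃)) perimeter≤)

  ceilHalf≤ : ∀ {a m} → a ≤ 2 * m → ceilHalf a ≤ m
  ceilHalf≤ {a} {m} a≤2m = ≤-pred (m<n*o⇒m/o<n {a + 1} {suc m} {2}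
    (subst (suc (a + 1) ≤_) 2+2m≡[1+m]*2 (s≤s (+-monoˡ-≤ 1 a≤2m))))
    where
    2+2m≡[1+m]*2 : suc (2 * m + 1) ≡ suc m * 2
    2+2m≡[1+m]*2 = solve (m ∷ [])

  m+n∸1≤m+o : ∀ m {n o} → n ≤ suc o → m + n ∸ 1 ≤ m + o
  m+n∸1≤m+o m {n} {o} n≤1+o = begin
    m + n ∸ 1     ≤⟨ ∸-monoˡ-≤ 1 (+-monoʳ-≤ m n≤1+o) ⟩
    m + suc o ∸ 1 ≡⟨ cong (_∸ 1) (+-suc m o) ⟩
    m + o         ∎
    where open ≤-Reasoning


module CycleDistance where

  open Arithmetic using ([n∸m]+[o∸n]≡o∸m)

  open import Data.Nat
  open import Data.Nat.Properties
  open import Data.Sum using (inj₁; inj₂)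
  open import Relation.Binary.PropositionalEquality
  open import Algebra.Properties.CommutativeSemigroup +-commutativeSemigroup

  cycDistℕ : ℕ → ℕ → ℕ → ℕ
  cycDistℕ n x y = ∣ x - y ∣ ⊓ (n ∸ ∣ x - y ∣)

  cycDistℕ-comm : ∀ n x y → cycDistℕ n x y ≡ cycDistℕ n y x
  cycDistℕ-comm n x y rewrite ∣-∣-comm x y = refl

  2*cycDistℕ≤n : ∀ n x y → 2 * cycDistℕ n x y ≤ n
  2*cycDistℕ≤n n x y rewrite +-identityʳ (cycDistℕ n x y) with ≤-total ∣ x - y ∣ n
  ... | inj₁ d≤n = begin
    cycDistℕ n x y + cycDistℕ n x y ≤⟨ +-mono-≤ (m⊓n≤m ∣ x - y ∣ _) (m⊓n≤n ∣ x - y ∣ _) ⟩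
    ∣ x - y ∣ + (n ∸ ∣ x - y ∣)     ≡⟨ m+[n∸m]≡n d≤n ⟩
    n                               ∎
    where open ≤-Reasoning
  ... | inj₂ n≤d = begin
    cycDistℕ n x y + cycDistℕ n x y ≤⟨ +-mono-≤ (m⊓n≤n ∣ x - y ∣ _) (m⊓n≤n ∣ x - y ∣ _) ⟩
    (n ∸ ∣ x - y ∣) + (n ∸ ∣ x - y ∣) ≡⟨ cong (λ e → e + e) (m≤n⇒m∸n≡0 n≤d) ⟩
    0                               ≤⟨ z≤n ⟩
    n                               ∎
    where open ≤-Reasoning

  perimeter : ℕ → ℕ → ℕ → ℕ → ℕ
  perimeter n x y z = cycDistℕ n x y + cycDistℕ n y z + cycDistℕ n x z

  perimeter-swap₁₂ : ∀ n x y z → perimeter n x y z ≡ perimeter n y x z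
  perimeter-swap₁₂ n x y z =
    trans (cong (λ d → d + cycDistℕ n y z + cycDistℕ n x z) (cycDistℕ-comm n x y))
          (xy∙z≈xz∙y (cycDistℕ n y x) (cycDistℕ n y z) (cycDistℕ n x z))

  perimeter-swap₂₃ : ∀ n x y z → perimeter n x y z ≡ perimeter n x z y
  perimeter-swap₂₃ n x y z =
    trans (xy∙z≈zy∙x (cycDistℕ n x y) (cycDistℕ n y z) (cycDistℕ n x z))
          (cong (λ d → cycDistℕ n x z + d + cycDistℕ n x y) (cycDistℕ-comm n y z))

  perimeter-sorted≤ : ∀ n {a b c} → a ≤ b → b ≤ c → c ≤ n → perimeter n a b c ≤ n
  perimeter-sorted≤ n {a} {b} {c} a≤b b≤c c≤n = begin
    perimeter n a b c
      ≤⟨ +-mono-≤ (+-mono-≤ (m⊓n≤m ∣ a - b ∣ _) (m⊓n≤m ∣ b - c ∣ _)) (m⊓n≤n ∣ a - c ∣ _) ⟩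
    ∣ a - b ∣ + ∣ b - c ∣ + (n ∸ ∣ a - c ∣) ≡⟨ cong (_+ (n ∸ ∣ a - c ∣)) gaps ⟩
    ∣ a - c ∣ + (n ∸ ∣ a - c ∣)             ≡⟨ m+[n∸m]≡n (≤-trans (∣m-n∣≤m⊔n a c) (⊔-lub a≤n c≤n)) ⟩
    n                                       ∎
    where
    open ≤-Reasoning
    a≤c = ≤-trans a≤b b≤c
    a≤n = ≤-trans a≤c c≤n
    gaps : ∣ a - b ∣ + ∣ b - c ∣ ≡ ∣ a - c ∣
    gaps = begin-equality
      ∣ a - b ∣ + ∣ b - c ∣ ≡⟨ cong₂ _+_ (m≤n⇒∣m-n∣≡n∸m a≤b) (m≤n⇒∣m-n∣≡n∸m b≤c) ⟩
      (b ∸ a) + (c ∸ b)     ≡⟨ [n∸m]+[o∸n]≡o∸m a≤b b≤c ⟩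
      c ∸ a                 ≡⟨ m≤n⇒∣m-n∣≡n∸m a≤c ⟨
      ∣ a - c ∣             ∎

  perimeter≤ : ∀ n {a b c} → a ≤ n → b ≤ n → c ≤ n → perimeter n a b c ≤ n
  perimeter≤ n {a} {b} {c} a≤n b≤n c≤n with ≤-total a b | ≤-total b c | ≤-total a c
  ... | inj₁ a≤b | inj₁ b≤c | _       = perimeter-sorted≤ n a≤b b≤c c≤n
  ... | inj₁ a≤b | inj₂ c≤b | inj₁ a≤c = subst (_≤ n) (sym (perimeter-swap₂₃ n a b c))
    (perimeter-sorted≤ n a≤c c≤b b≤n)
  ... | inj₁ a≤b | inj₂ c≤b | inj₂ c≤a = subst (_≤ n)
    (sym (trans (perimeter-swap₂₃ n a b c) (perimeter-swap₁₂ n a c b)))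
    (perimeter-sorted≤ n c≤a a≤b b≤n)
  ... | inj₂ b≤a | inj₁ b≤c | inj₁ a≤c = subst (_≤ n) (sym (perimeter-swap₁₂ n a b c))
    (perimeter-sorted≤ n b≤a a≤c c≤n)
  ... | inj₂ b≤a | inj₁ b≤c | inj₂ c≤a = subst (_≤ n)
    (sym (trans (perimeter-swap₁₂ n a b c) (perimeter-swap₂₃ n b a c)))
    (perimeter-sorted≤ n b≤c c≤a a≤n)
  ... | inj₂ b≤a | inj₂ c≤b | _       = subst (_≤ n)
    (sym (trans (perimeter-swap₁₂ n a b c) (trans (perimeter-swap₂₃ n b a c) (perimeter-swap₁₂ n b c a))))
    (perimeter-sorted≤ n c≤b b≤a a≤n)

module SignedSteps where

  open CycleDistance

  open import Data.Nat as ℕ using (ℕ; _∸_)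
  import Data.Nat.Properties as ℕ
  import Data.Nat.Divisibility as ℕ
  open import Data.Integer
  open import Data.Integer.Properties
  open import Data.Integer.Divisibility.Signed
  open import Data.Integer.Tactic.RingSolver using (solve)
  open import Algebra.Properties.AbelianGroup +-0-abelianGroup using (⁻¹-anti-homo‿-)
  open import Data.List using (_∷_; [])
  open import Data.Product using (∃-syntax; _×_; _,_)
  open import Data.Sum using (_⊎_; inj₁; inj₂)
  open import Relation.Binary.PropositionalEquality

  +[m∸n]≡+m-+n : ∀ {m n} → n ℕ.≤ m → + (m ∸ n) ≡ + m - + n
  +[m∸n]≡+m-+n {m} {n} n≤m = trans (sym (⊖-≥ n≤m)) (sym (m-n≡m⊖n m n))

  +∣m-n∣≡± : ∀ m n → (+ ℕ.∣ m - n ∣ ≡ + n - + m) ⊎ (+ ℕ.∣ m - n ∣ ≡ - (+ n - + m))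
  +∣m-n∣≡± m n with ℕ.≤-total m n
  ... | inj₁ m≤n = inj₁ (trans (cong +_ (ℕ.m≤n⇒∣m-n∣≡n∸m m≤n)) (+[m∸n]≡+m-+n m≤n))
  ... | inj₂ n≤m = inj₂ (begin
    + ℕ.∣ m - n ∣   ≡⟨ cong +_ (ℕ.m≤n⇒∣n-m∣≡n∸m n≤m) ⟩
    + (m ∸ n)       ≡⟨ +[m∸n]≡+m-+n n≤m ⟩
    + m - + n       ≡⟨ ⁻¹-anti-homo‿- (+ n) (+ m) ⟨
    - (+ n - + m)   ∎)
    where open ≡-Reasoning

  ∣+m-+n∣≡∣m-n∣ : ∀ m n → ∣ + m - + n ∣ ≡ ℕ.∣ m - n ∣
  ∣+m-+n∣≡∣m-n∣ m n with +∣m-n∣≡± m n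
  ... | inj₁ eq = trans (∣i-j∣≡∣j-i∣ (+ m) (+ n)) (cong ∣_∣ (sym eq))
  ... | inj₂ eq = trans (trans (∣i-j∣≡∣j-i∣ (+ m) (+ n)) (sym (∣-i∣≡∣i∣ (+ n - + m)))) (cong ∣_∣ (sym eq))

  +cycDistℕ≡± : ∀ n x y → ℕ.∣ x - y ∣ ℕ.≤ n →
    (+ cycDistℕ n x y ≡ + ℕ.∣ x - y ∣) ⊎ (+ cycDistℕ n x y ≡ + n - + ℕ.∣ x - y ∣)
  +cycDistℕ≡± n x y d≤n with ℕ.⊓-sel ℕ.∣ x - y ∣ (n ∸ ℕ.∣ x - y ∣)
  ... | inj₁ eq = inj₁ (cong +_ eq)
  ... | inj₂ eq = inj₂ (trans (cong +_ eq) (+[m∸n]≡+m-+n d≤n))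

  Δ≡±c-mod : ∀ {N Δ D c} → (D ≡ Δ) ⊎ (D ≡ - Δ) → (c ≡ D) ⊎ (c ≡ N - D) → (N ∣ Δ - c) ⊎ (N ∣ Δ + c)
  Δ≡±c-mod {N} {Δ} (inj₁ refl) (inj₁ refl) = inj₁ (subst (N ∣_) (sym (+-inverseʳ Δ)) (∣ᵤ⇒∣ (∣ N ∣ ℕ.∣0)))
  Δ≡±c-mod {N} {Δ} (inj₂ refl) (inj₁ refl) = inj₂ (subst (N ∣_) (sym (+-inverseʳ Δ)) (∣ᵤ⇒∣ (∣ N ∣ ℕ.∣0)))
  Δ≡±c-mod {N} {Δ} (inj₁ refl) (inj₂ refl) = inj₂ (subst (N ∣_) (sym Δ+[N-Δ]≡N) ∣-refl)
    where
    Δ+[N-Δ]≡N : Δ + (N - Δ) ≡ N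
    Δ+[N-Δ]≡N = solve (N ∷ Δ ∷ [])
  Δ≡±c-mod {N} {Δ} (inj₂ refl) (inj₂ refl) = inj₁ (subst (N ∣_) (sym Δ-[N+Δ]≡-N) (∣m⇒∣-m ∣-refl))
    where
    Δ-[N+Δ]≡-N : Δ - (N - - Δ) ≡ - N
    Δ-[N+Δ]≡-N = solve (N ∷ Δ ∷ [])

  private
    x-[y-z]≡[x-y]+z : ∀ x y z → x - (y - z) ≡ (x - y) + z
    x-[y-z]≡[x-y]+z x y z = solve (x ∷ y ∷ z ∷ [])

    x-[y-z]≡[x+z]-y : ∀ x y z → x - (y - z) ≡ (x + z) - y
    x-[y-z]≡[x+z]-y x y z = solve (x ∷ y ∷ z ∷ [])

  cycDistℕ-congruent : ∀ n x y → ℕ.∣ x - y ∣ ℕ.≤ n →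
    (+ n ∣ (+ y - + x) - + cycDistℕ n x y) ⊎ (+ n ∣ (+ y - + x) + + cycDistℕ n x y)
  cycDistℕ-congruent n x y d≤n = Δ≡±c-mod (+∣m-n∣≡± x y) (+cycDistℕ≡± n x y d≤n)

  signed-step : ∀ {n p h} x y → p ℕ.∣ n → p ℕ.∣ h → ℕ.∣ x - y ∣ ℕ.≤ n →
    ∃[ δ ] ∣ δ ∣ ≡ ℕ.∣ cycDistℕ n x y - h ∣ × + p ∣ (+ y - + x) - δ
  signed-step {n} {p} {h} x y p∣n p∣h d≤n with cycDistℕ-congruent n x y d≤n
  ... | inj₁ n∣Δ-c = c - + h , ∣+m-+n∣≡∣m-n∣ _ h ,
    subst (+ p ∣_) (sym (x-[y-z]≡[x-y]+z Δ c (+ h))) (∣m∣n⇒∣m+n (∣-trans (∣ᵤ⇒∣ p∣n) n∣Δ-c) (∣ᵤ⇒∣ p∣h))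
    where
    Δ = + y - + x
    c = + cycDistℕ n x y
  ... | inj₂ n∣Δ+c = + h - c , trans (∣+m-+n∣≡∣m-n∣ h (cycDistℕ n x y)) (ℕ.∣-∣-comm h _) ,
    subst (+ p ∣_) (sym (x-[y-z]≡[x+z]-y Δ (+ h) c)) (∣m∣n⇒∣m-n (∣-trans (∣ᵤ⇒∣ p∣n) n∣Δ+c) (∣ᵤ⇒∣ p∣h))
    where
    Δ = + y - + x
    c = + cycDistℕ n x y

module Walks where

  open import Data.Nat as ℕ using (ℕ; zero; suc)
  import Data.Nat.Properties as ℕ
  open import Data.Integer
  open import Data.Integer.Properties
  open import Data.Sum using (inj₁; inj₂)
  import Algebra.Properties.CommutativeSemigroup ℕ.+-commutativeSemigroup as ℕ-comm
  import Algebra.Properties.CommutativeSemigroup +-commutativeSemigroup as ℤ-comm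
  open import Relation.Binary.PropositionalEquality

  walk : ℤ → (ℕ → ℤ) → ℕ → ℤ
  walk a δ zero    = a
  walk a δ (suc j) = walk a δ j + δ j

  variation : (ℕ → ℤ) → ℕ → ℕ
  variation δ zero    = 0
  variation δ (suc j) = variation δ j ℕ.+ ∣ δ j ∣

  walk-displacement+variation≤ : ∀ a δ i d →
    ∣ walk a δ (d ℕ.+ i) - walk a δ i ∣ ℕ.+ variation δ i ℕ.≤ variation δ (d ℕ.+ i)
  walk-displacement+variation≤ a δ i zero rewrite +-inverseʳ (walk a δ i) = ℕ.≤-refl
  walk-displacement+variation≤ a δ i (suc d) = begin
    ∣ W (d ℕ.+ i) + δ (d ℕ.+ i) - W i ∣ ℕ.+ variation δ i
      ≡⟨ cong (λ e → ∣ e ∣ ℕ.+ variation δ i) (ℤ-comm.xy∙z≈xz∙y (W (d ℕ.+ i)) (δ (d ℕ.+ i)) (- W i)) ⟩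
    ∣ (W (d ℕ.+ i) - W i) + δ (d ℕ.+ i) ∣ ℕ.+ variation δ i
      ≤⟨ ℕ.+-monoˡ-≤ (variation δ i) (∣i+j∣≤∣i∣+∣j∣ (W (d ℕ.+ i) - W i) (δ (d ℕ.+ i))) ⟩
    ∣ W (d ℕ.+ i) - W i ∣ ℕ.+ ∣ δ (d ℕ.+ i) ∣ ℕ.+ variation δ i
      ≡⟨ ℕ-comm.xy∙z≈xz∙y ∣ W (d ℕ.+ i) - W i ∣ ∣ δ (d ℕ.+ i) ∣ (variation δ i) ⟩
    ∣ W (d ℕ.+ i) - W i ∣ ℕ.+ variation δ i ℕ.+ ∣ δ (d ℕ.+ i) ∣
      ≤⟨ ℕ.+-monoˡ-≤ ∣ δ (d ℕ.+ i) ∣ (walk-displacement+variation≤ a δ i d) ⟩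
    variation δ (d ℕ.+ i) ℕ.+ ∣ δ (d ℕ.+ i) ∣ ∎
    where
    open ℕ.≤-Reasoning
    W = walk a δ

  variation-mono : ∀ δ {i j} → i ℕ.≤ j → variation δ i ℕ.≤ variation δ j
  variation-mono δ {i} {j} i≤j = subst (λ k → variation δ i ℕ.≤ variation δ k) (ℕ.m∸n+n≡m i≤j)
    (ℕ.≤-trans (ℕ.m≤n+m _ _) (walk-displacement+variation≤ 0ℤ δ i (j ℕ.∸ i)))

  ∣walk-walk∣≤variation : ∀ a δ {i j t} → i ℕ.≤ j → j ℕ.≤ t →
    ∣ walk a δ j - walk a δ i ∣ ℕ.≤ variation δ t
  ∣walk-walk∣≤variation a δ {i} {j} i≤j j≤t = ℕ.≤-trans (ℕ.m≤m+n _ (variation δ i)) (ℕ.≤-trans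
    (subst (λ k → ∣ walk a δ k - walk a δ i ∣ ℕ.+ variation δ i ℕ.≤ variation δ k) (ℕ.m∸n+n≡m i≤j)
      (walk-displacement+variation≤ a δ i (j ℕ.∸ i)))
    (variation-mono δ j≤t))

  walk-spread≤variation : ∀ a δ {i j t} → i ℕ.≤ t → j ℕ.≤ t →
    ∣ walk a δ i - walk a δ j ∣ ℕ.≤ variation δ t
  walk-spread≤variation a δ {i} {j} i≤t j≤t with ℕ.≤-total i j
  ... | inj₁ i≤j = subst (ℕ._≤ _) (∣i-j∣≡∣j-i∣ (walk a δ j) (walk a δ i)) (∣walk-walk∣≤variation a δ i≤j j≤t)
  ... | inj₂ j≤i = ∣walk-walk∣≤variation a δ j≤i i≤t

module Pigeonhole where

  open SignedSteps using (∣+m-+n∣≡∣m-n∣)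

  open import Data.Nat as ℕ using (ℕ; zero; suc; NonZero; _/_; _%_; z≤n; s≤s)
  import Data.Nat.Properties as ℕ
  import Data.Nat.Divisibility as ℕ
  open import Data.Nat.DivMod using (m≡m%n+[m/n]*n; %-remove-+ʳ; m<n*o⇒m/o<n)
  open import Data.Integer hiding (NonZero; _/_; _%_; suc)
  open import Data.Integer.Properties
  open import Data.Integer.Divisibility.Signed
  open import Algebra.Properties.AbelianGroup +-0-abelianGroup using (⁻¹-anti-homo‿-; ∙-cancelʳ)
  open import Data.Fin as Fin using (Fin; toℕ; fromℕ<; combine)
  import Data.Fin.Properties as Fin
  open import Data.Product using (∃-syntax; _×_; _,_; proj₁; proj₂)
  open import Data.Sum using (inj₁; inj₂)
  open import Relation.Binary.PropositionalEquality

  d∣∣m-n∣⇒m%d≡n%d : ∀ {m n d} .{{_ : NonZero d}} → d ℕ.∣ ℕ.∣ m - n ∣ → m % d ≡ n % d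
  d∣∣m-n∣⇒m%d≡n%d {m} {n} d∣ with ℕ.≤-total m n
  ... | inj₁ m≤n = sym (trans (cong (_% _) (sym (ℕ.m+[n∸m]≡n m≤n)))
                              (%-remove-+ʳ m (subst (_ ℕ.∣_) (ℕ.m≤n⇒∣m-n∣≡n∸m m≤n) d∣)))
  ... | inj₂ n≤m = trans (cong (_% _) (sym (ℕ.m+[n∸m]≡n n≤m)))
                         (%-remove-+ʳ n (subst (_ ℕ.∣_) (ℕ.m≤n⇒∣n-m∣≡n∸m n≤m) d∣))

  %-/-injective : ∀ {m n d} .{{_ : NonZero d}} → m % d ≡ n % d → m / d ≡ n / d → m ≡ n
  %-/-injective {m} {n} {d} m%≡n% m/≡n/ = begin
    m                   ≡⟨ m≡m%n+[m/n]*n m d ⟩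
    m % d ℕ.+ m / d ℕ.* d ≡⟨ cong₂ (λ r q → r ℕ.+ q ℕ.* d) m%≡n% m/≡n/ ⟩
    n % d ℕ.+ n / d ℕ.* d ≡⟨ m≡m%n+[m/n]*n n d ⟨
    n                   ∎
    where open ≡-Reasoning

  lower-bound-extend : ∀ (P : ℕ → ℤ) {a t} → (∀ {j} → j ℕ.≤ t → a ≤ P j) → a ≤ P (suc t) →
    ∀ {j} → j ℕ.≤ suc t → a ≤ P j
  lower-bound-extend P below below-last {j} j≤1+t with ℕ.m≤n⇒m<n∨m≡n j≤1+t
  ... | inj₁ (s≤s j≤t) = below j≤t
  ... | inj₂ refl      = below-last

  minimiser : (P : ℕ → ℤ) (t : ℕ) → ∃[ m ] m ℕ.≤ t × (∀ {j} → j ℕ.≤ t → P m ≤ P j)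
  minimiser P zero = zero , z≤n , λ { ℕ.z≤n → ≤-refl }
  minimiser P (suc t) with minimiser P t
  ... | m , m≤t , min with ≤-total (P m) (P (suc t))
  ... | inj₁ Pm≤ = m , ℕ.m≤n⇒m≤1+n m≤t , lower-bound-extend P min Pm≤
  ... | inj₂ P≤Pm = suc t , ℕ.≤-refl , lower-bound-extend P (λ j≤t → ≤-trans P≤Pm (min j≤t)) ≤-refl

  congruent-to-same⇒%≡ : ∀ {m n p} .{{_ : ℕ.NonZero p}} {a : ℤ} →
    + p ∣ + m - a → + p ∣ + n - a → m % p ≡ n % p
  congruent-to-same⇒%≡ {m} {n} {p} {a} p∣m-a p∣n-a = d∣∣m-n∣⇒m%d≡n%d
    (subst (p ℕ.∣_) (∣+m-+n∣≡∣m-n∣ m n)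
      (∣⇒∣ᵤ (subst (+ p ∣_) (+-minus-telescope (+ m) a (+ n))
        (∣m∣n⇒∣m+n p∣m-a (subst (+ p ∣_) (⁻¹-anti-homo‿- (+ n) a) (∣m⇒∣-m p∣n-a))))))

  ≤-∣-∣-injective : ∀ {a i j} → a ≤ i → a ≤ j → ∣ a - i ∣ ≡ ∣ a - j ∣ → i ≡ j
  ≤-∣-∣-injective {a} {i} {j} a≤i a≤j eq = ∙-cancelʳ (- a) i j (begin
    i - a         ≡⟨ ∣-∣-≤ a≤i ⟨
    + ∣ a - i ∣   ≡⟨ cong +_ eq ⟩
    + ∣ a - j ∣   ≡⟨ ∣-∣-≤ a≤j ⟩
    j - a         ∎)
    where open ≡-Reasoning

  -- Each value w j is pinned down by its block w j / p and, through P j, by its residue mod p.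
  count≤window*blocks : ∀ {t W q p} .{{_ : ℕ.NonZero p}} (w : ℕ → ℕ) (P : ℕ → ℤ) →
    (∀ {j} → j ℕ.≤ t → w j ℕ.< q ℕ.* p) →
    (∀ {i j} → i ℕ.≤ t → j ℕ.≤ t → w i ≡ w j → i ≡ j) →
    (∀ {j} → j ℕ.≤ t → + p ∣ + w j - P j) →
    (∀ {i j} → i ℕ.≤ t → j ℕ.≤ t → ∣ P i - P j ∣ ℕ.≤ W) →
    suc t ℕ.≤ suc W ℕ.* q
  count≤window*blocks {t} {W} {q} {p} w P w<qp w-injective p∣w-P spread≤W =
    Fin.injective⇒≤ {f = code} code-injective
    where
    m = proj₁ (minimiser P t)
    m≤t = proj₁ (proj₂ (minimiser P t))
    Pm≤ = proj₂ (proj₂ (minimiser P t))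

    ≤t : (i : Fin (suc t)) → toℕ i ℕ.≤ t
    ≤t i = ℕ.≤-pred (Fin.toℕ<n i)

    offset : Fin (suc t) → Fin (suc W)
    offset i = fromℕ< (s≤s (spread≤W m≤t (≤t i)))

    block : Fin (suc t) → Fin q
    block i = fromℕ< (m<n*o⇒m/o<n (w<qp (≤t i)))

    code : Fin (suc t) → Fin (suc W ℕ.* q)
    code i = combine (offset i) (block i)

    code-injective : ∀ {i j} → code i ≡ code j → i ≡ j
    code-injective {i} {j} eq = Fin.toℕ-injective (w-injective (≤t i) (≤t j)
      (%-/-injective (congruent-to-same⇒%≡ {a = P (toℕ i)} (p∣w-P (≤t i)) p∣wj-Pi) same-block))
      where
      parts = Fin.combine-injective (offset i) (block i) (offset j) (block j) eq
      same-P : P (toℕ i) ≡ P (toℕ j)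
      same-P = ≤-∣-∣-injective (Pm≤ (≤t i)) (Pm≤ (≤t j))
        (trans (sym (Fin.toℕ-fromℕ< _)) (trans (cong toℕ (proj₁ parts)) (Fin.toℕ-fromℕ< _)))
      p∣wj-Pi : + p ∣ + w (toℕ j) - P (toℕ i)
      p∣wj-Pi = subst (λ a → + p ∣ + w (toℕ j) - a) (sym same-P) (p∣w-P (≤t j))
      same-block : w (toℕ i) / p ≡ w (toℕ j) / p
      same-block = trans (sym (Fin.toℕ-fromℕ< _)) (trans (cong toℕ (proj₂ parts)) (Fin.toℕ-fromℕ< _))

module LabelOrder where

  open import Data.Nat using (ℕ; suc; _≤_; _<_; _<?_; s≤s)
  import Data.Nat.Properties as ℕ
  open import Data.Fin as Fin using (Fin; toℕ; fromℕ<)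
  import Data.Fin.Properties as Fin
  open import Data.List using (List; _∷_; length; lookup; allFin)
  import Data.List.Properties as List
  open import Data.List.Relation.Unary.All using (All; _∷_)
  open import Data.List.Relation.Unary.AllPairs using (AllPairs; _∷_)
  open import Data.List.Relation.Unary.Unique.Propositional using (Unique)
  open import Data.List.Relation.Unary.Unique.Propositional.Properties using (allFin⁺)
  open import Data.List.Relation.Binary.Permutation.Setoid.Properties using (Unique-resp-↭)
  open import Data.List.Relation.Binary.Permutation.Propositional using (↭-sym; ↭⇒↭ₛ)
  open import Data.List.Relation.Binary.Permutation.Propositional.Properties using (↭-length)
  import Data.List.Relation.Unary.Sorted.TotalOrder.Properties as Sorted
  import Relation.Binary.Construct.On as On
  open import Relation.Binary.Bundles using (DecTotalOrder)
  open import Relation.Binary.Definitions using (tri<; tri≈; tri>)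
  open import Relation.Binary.PropositionalEquality
  open import Relation.Nullary using (yes; no)
  open import Data.Empty using (⊥-elim)

  record SortedEnumeration (n : ℕ) (f : Fin n → ℕ) : Set where
    field
      vertex           : ℕ → Fin n
      vertex-injective : ∀ {i j} → i < n → j < n → vertex i ≡ vertex j → i ≡ j
      label-mono       : ∀ {i j} → i ≤ j → j < n → f (vertex i) ≤ f (vertex j)

  private
    All-lookup : ∀ {A : Set} {P : A → Set} {xs : List A} → All P xs → (i : Fin (length xs)) → P (lookup xs i)
    All-lookup (px ∷ pxs) Fin.zero    = px
    All-lookup (px ∷ pxs) (Fin.suc i) = All-lookup pxs i

    AllPairs-lookup : ∀ {A : Set} {R : A → A → Set} {xs : List A} → AllPairs R xs →
      ∀ {i j : Fin (length xs)} → toℕ i < toℕ j → R (lookup xs i) (lookup xs j)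
    AllPairs-lookup (px ∷ pxs) {Fin.zero}  {Fin.suc j} _         = All-lookup px j
    AllPairs-lookup (px ∷ pxs) {Fin.suc i} {Fin.suc j} (s≤s i<j) = AllPairs-lookup pxs i<j

  sortedEnumeration : ∀ {n} (f : Fin (suc n) → ℕ) → SortedEnumeration (suc n) f
  sortedEnumeration {n} f = record
    { vertex = vertex ; vertex-injective = vertex-injective ; label-mono = label-mono }
    where
    byLabel : DecTotalOrder _ _ _
    byLabel = On.decTotalOrder ℕ.≤-decTotalOrder f
    open import Data.List.Sort byLabel using (sort; sort-↭; sort-↗)

    sorted : List (Fin (suc n))
    sorted = sort (allFin (suc n))

    length-sorted : length sorted ≡ suc n
    length-sorted = trans (↭-length (sort-↭ (allFin (suc n)))) (List.length-tabulate (λ i → i))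

    unique-sorted : Unique sorted
    unique-sorted =
      Unique-resp-↭ (setoid (Fin (suc n))) (↭⇒↭ₛ (↭-sym (sort-↭ (allFin (suc n))))) (allFin⁺ (suc n))

    position : ∀ {i} → i < suc n → Fin (length sorted)
    position i<n = fromℕ< (subst (_ <_) (sym length-sorted) i<n)

    vertex : ℕ → Fin (suc n)
    vertex i with i <? suc n
    ... | yes i<n = lookup sorted (position i<n)
    ... | no _    = Fin.zero

    vertex≡ : ∀ {i} (i<n : i < suc n) → vertex i ≡ lookup sorted (position i<n)
    vertex≡ {i} i<n with i <? suc n
    ... | yes _   = cong (lookup sorted) (Fin.fromℕ<-cong _ _ refl _ _)
    ... | no i≮n = ⊥-elim (i≮n i<n)

    vertex-distinct : ∀ {i j} → i < j → j < suc n → vertex i ≢ vertex j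
    vertex-distinct {i} {j} i<j j<n eq = AllPairs-lookup unique-sorted
      (subst₂ _<_ (sym (Fin.toℕ-fromℕ< _)) (sym (Fin.toℕ-fromℕ< _)) i<j)
      (trans (sym (vertex≡ i<n)) (trans eq (vertex≡ j<n)))
      where i<n = ℕ.<-trans i<j j<n

    vertex-injective : ∀ {i j} → i < suc n → j < suc n → vertex i ≡ vertex j → i ≡ j
    vertex-injective {i} {j} i<n j<n eq with ℕ.<-cmp i j
    ... | tri< i<j _ _ = ⊥-elim (vertex-distinct i<j j<n eq)
    ... | tri≈ _ i≡j _ = i≡j
    ... | tri> _ _ j<i = ⊥-elim (vertex-distinct j<i i<n (sym eq))

    label-mono : ∀ {i j} → i ≤ j → j < suc n → f (vertex i) ≤ f (vertex j)
    label-mono {i} {j} i≤j j<n = subst₂ (λ a b → f a ≤ f b) (sym (vertex≡ i<n)) (sym (vertex≡ j<n))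
      (Sorted.lookup-mono-≤ (DecTotalOrder.totalOrder byLabel) (sort-↗ (allFin (suc n)))
        (subst₂ _≤_ (sym (Fin.toℕ-fromℕ< _)) (sym (Fin.toℕ-fromℕ< _)) i≤j))
      where i<n = ℕ.≤-<-trans i≤j j<n

module Span where

  open import Data.Nat using (ℕ; _≤_; _⊔_; ∣_-_∣)
  import Data.Nat.Properties as ℕ
  open import Data.Fin using (Fin)
  open import Data.List using (List; _∷_; foldr; map; allFin)
  open import Data.List.Membership.Propositional using (_∈_)
  open import Data.List.Membership.Propositional.Properties using (∈-concatMap⁺; ∈-map⁺; ∈-allFin)
  open import Data.List.Relation.Unary.Any using (here; there)
  import Data.List.Relation.Unary.Any as Any
  open import Relation.Binary.PropositionalEquality using (refl)

  ∈⇒≤foldr-⊔ : ∀ {x} {xs : List ℕ} → x ∈ xs → x ≤ foldr _⊔_ 0 xs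
  ∈⇒≤foldr-⊔ {xs = y ∷ ys} (here refl) = ℕ.m≤m⊔n y _
  ∈⇒≤foldr-⊔ {xs = y ∷ ys} (there x∈ys) = ℕ.≤-trans (∈⇒≤foldr-⊔ x∈ys) (ℕ.m≤n⊔m y _)

  ∣f-f∣≤span : ∀ {n} (f : Fin n → ℕ) (u v : Fin n) → ∣ f u - f v ∣ ≤ span n f
  ∣f-f∣≤span {n} f u v = ∈⇒≤foldr-⊔ (∈-concatMap⁺ (λ u′ → map (λ v′ → ∣ f u′ - f v′ ∣) (allFin n))
    (Any.map (λ { refl → ∈-map⁺ (λ v′ → ∣ f u - f v′ ∣) (∈-allFin v) }) (∈-allFin u)))

open import Data.Nat
open import Data.Nat.Properties
open import Data.Nat.Divisibility using (_∣_; _∣0)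
open import Data.Nat.DivMod using (m*n/n≡m; m*n%n≡0; [m+kn]%n≡m%n; +-distrib-/)
open import Data.Nat.GCD using (gcd[m,n]∣m; gcd[m,n]∣n; gcd[m,n]≢0)
open import Data.Nat.Tactic.RingSolver using (solve-∀)
open import Data.Integer as ℤ using (ℤ)
import Data.Integer.Properties as ℤ
import Data.Integer.Divisibility.Signed as ℤ
import Data.Integer.Tactic.RingSolver as ℤ
open import Data.Fin as Fin using (Fin; toℕ)
import Data.Fin.Properties as Fin
open import Data.Product using (∃-syntax; _×_; _,_; proj₁; proj₂)
open import Data.Sum using (_⊎_; inj₁; inj₂)
open import Data.Empty using (⊥-elim)
open import Relation.Binary.PropositionalEquality
open import Algebra.Properties.CommutativeSemigroup +-commutativeSemigroup using (xy∙z≈yz∙x; x∙yz≈zx∙y)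

open Arithmetic
open CycleDistance
open SignedSteps using (signed-step)
open Walks
open Pigeonhole using (count≤window*blocks)
open LabelOrder
open Span

odd∨even : ∀ m → (∃[ t ] m ≡ suc (2 * t)) ⊎ (∃[ t ] m ≡ 2 * t)
odd∨even zero = inj₂ (0 , refl)
odd∨even (suc m) with odd∨even m
... | inj₁ (t , refl) = inj₂ (suc t , sym (*-suc 2 t))
... | inj₂ (t , refl) = inj₁ (t , refl)

[2t]%2≡0 : ∀ t → 2 * t % 2 ≡ 0
[2t]%2≡0 t = trans (cong (_% 2) (*-comm 2 t)) (m*n%n≡0 t 2)

[1+2t]%2≡1 : ∀ t → suc (2 * t) % 2 ≡ 1
[1+2t]%2≡1 t = trans (cong (λ m → suc m % 2) (*-comm 2 t)) ([m+kn]%n≡m%n 1 t 2)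

2t/2≡t : ∀ t → 2 * t / 2 ≡ t
2t/2≡t t = trans (cong (_/ 2) (*-comm 2 t)) (m*n/n≡m t 2)

[1+2t]/2≡t : ∀ t → suc (2 * t) / 2 ≡ t
[1+2t]/2≡t t = trans (cong (λ m → suc m / 2) (*-comm 2 t))
  (trans (+-distrib-/ 1 (t * 2) (subst (λ r → 1 + r < 2) (sym (m*n%n≡0 t 2)) ≤-refl)) (m*n/n≡m t 2))

LB-odd : ∀ {n k t} → n ≡ suc (2 * t) → LB n k ≡ Φ n k * t
LB-odd {k = k} {t} refl with suc (2 * t) % 2 | [1+2t]%2≡1 t
... | .1 | refl = cong (Φ (suc (2 * t)) k *_) (2t/2≡t t)

LB-even : ∀ {n k t} → n ≡ 2 * suc t → LB n k ≡ Φ n k * t + k + 1 ∸ suc t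
LB-even {k = k} {t} refl with 2 * suc t % 2 | [2t]%2≡0 (suc t)
... | .0 | refl = cong₂ (λ a b → Φ (2 * suc t) k * a + k + 1 ∸ b)
  (trans (cong (λ m → (m ∸ 2) / 2) (*-suc 2 t)) (2t/2≡t t)) (2t/2≡t (suc t))

k+1+[n∸k∸1]≡n : ∀ {n k} → k < n → k + 1 + (n ∸ k ∸ 1) ≡ n
k+1+[n∸k∸1]≡n {n} {k} k<n =
  trans (cong (k + 1 +_) (∸-+-assoc n k 1)) (m+[n∸m]≡n (subst (_≤ n) (+-comm 1 k) k<n))

k+1+hh+hh≡n : ∀ {n k} → k < n → n % 2 ≢ k % 2 → k + 1 + hh n k + hh n k ≡ n
k+1+hh+hh≡n {n} {k} k<n n%2≢k%2 with odd∨even (n ∸ k ∸ 1)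
... | inj₁ (s , r≡1+2s) = ⊥-elim (n%2≢k%2 (begin
  n % 2                     ≡⟨ cong (_% 2) (k+1+[n∸k∸1]≡n k<n) ⟨
  (k + 1 + (n ∸ k ∸ 1)) % 2 ≡⟨ cong (λ m → (k + 1 + m) % 2) r≡1+2s ⟩
  (k + 1 + suc (2 * s)) % 2 ≡⟨ cong (_% 2) (rearrange k s) ⟩
  (k + suc s * 2) % 2       ≡⟨ [m+kn]%n≡m%n k (suc s) 2 ⟩
  k % 2                     ∎))
  where
  open ≡-Reasoning
  rearrange : ∀ k s → k + 1 + suc (2 * s) ≡ k + suc s * 2
  rearrange = solve-∀
... | inj₂ (s , r≡2s) = begin
  k + 1 + hh n k + hh n k   ≡⟨ cong (λ m → k + 1 + m + m) (trans (cong (_/ 2) r≡2s) (2t/2≡t s)) ⟩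
  k + 1 + s + s             ≡⟨ rearrange k s ⟩
  k + 1 + 2 * s             ≡⟨ cong (k + 1 +_) r≡2s ⟨
  k + 1 + (n ∸ k ∸ 1)       ≡⟨ k+1+[n∸k∸1]≡n k<n ⟩
  n                         ∎
  where
  open ≡-Reasoning
  rearrange : ∀ k s → k + 1 + s + s ≡ k + 1 + 2 * s
  rearrange = solve-∀

n≤1+2[n/2] : ∀ n → n ≤ suc (2 * (n / 2))
n≤1+2[n/2] n with odd∨even n
... | inj₁ (t , refl) = ≤-reflexive (cong (λ u → suc (2 * u)) (sym ([1+2t]/2≡t t)))
... | inj₂ (t , refl) = subst (λ u → 2 * t ≤ suc (2 * u)) (sym (2t/2≡t t)) (n≤1+n _)

n/2≤k⇒h≤k+1 : ∀ {n k h} → n / 2 ≤ k → k + 1 + h + h ≡ n → h ≤ k + 1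
n/2≤k⇒h≤k+1 {n} {k} {h} n/2≤k k+1+h+h≡n = ≤-trans (m≤m+n h h) (≤-trans h+h≤k (m≤m+n k 1))
  where
  h+h≤k : h + h ≤ k
  h+h≤k = +-cancelˡ-≤ (k + 1) (h + h) k (begin
    k + 1 + (h + h)     ≡⟨ +-assoc (k + 1) h h ⟨
    k + 1 + h + h       ≡⟨ k+1+h+h≡n ⟩
    n                   ≤⟨ n≤1+2[n/2] n ⟩
    suc (2 * (n / 2))   ≤⟨ s≤s (*-monoʳ-≤ 2 n/2≤k) ⟩
    suc (2 * k)         ≡⟨ rearrange k ⟩
    k + 1 + k           ∎)
    where
    open ≤-Reasoning
    rearrange : ∀ k → suc (2 * k) ≡ k + 1 + k
    rearrange = solve-∀

Φ≡k+1∸h : ∀ {n k h} → h ≤ k + 1 → k + 1 + h + h ≡ n → Φ n k ≡ k + 1 ∸ h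
Φ≡k+1∸h {n} {k} {h} h≤k+1 k+1+h+h≡n = begin
  ceilHalf (3 * k + 3 ∸ n)   ≡⟨ cong (λ m → ceilHalf (m ∸ n)) 3k+3≡2Ψ+n ⟩
  ceilHalf (2 * Ψ + n ∸ n)   ≡⟨ cong ceilHalf (m+n∸n≡m (2 * Ψ) n) ⟩
  (2 * Ψ + 1) / 2            ≡⟨ cong (_/ 2) (+-comm (2 * Ψ) 1) ⟩
  suc (2 * Ψ) / 2            ≡⟨ [1+2t]/2≡t Ψ ⟩
  Ψ                          ∎
  where
  open ≡-Reasoning
  Ψ = k + 1 ∸ h
  Ψ+h≡k+1 : Ψ + h ≡ k + 1
  Ψ+h≡k+1 = m∸n+n≡m h≤k+1
  3k+3≡2Ψ+n : 3 * k + 3 ≡ 2 * Ψ + n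
  3k+3≡2Ψ+n = begin
    3 * k + 3                   ≡⟨ *-distribˡ-+ 3 k 1 ⟨
    3 * (k + 1)                 ≡⟨ cong (3 *_) Ψ+h≡k+1 ⟨
    3 * (Ψ + h)                 ≡⟨ rearrange Ψ h ⟩
    2 * Ψ + (Ψ + h + h + h)     ≡⟨ cong (λ m → 2 * Ψ + (m + h + h)) Ψ+h≡k+1 ⟩
    2 * Ψ + (k + 1 + h + h)     ≡⟨ cong (2 * Ψ +_) k+1+h+h≡n ⟩
    2 * Ψ + n                   ∎
    where
    rearrange : ∀ a b → 3 * (a + b) ≡ 2 * a + (a + b + b + b)
    rearrange = solve-∀

module RadioLabelling
  {n k h p : ℕ} .{{_ : NonZero n}} .{{_ : NonZero p}}
  (k+1+h+h≡n : k + 1 + h + h ≡ n) (h≤k+1 : h ≤ k + 1) (p∣n : p ∣ n) (p∣h : p ∣ h)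
  {f : Fin n → ℕ} (radio : IsRadioLabeling n k f) (order : SortedEnumeration n f) where

  open SortedEnumeration order

  Ψ : ℕ
  Ψ = k + 1 ∸ h

  label : ℕ → ℕ
  label i = f (vertex i)

  position : ℕ → ℕ
  position i = toℕ (vertex i)

  position≤n : ∀ i → position i ≤ n
  position≤n i = <⇒≤ (Fin.toℕ<n (vertex i))

  ∣position-position∣≤n : ∀ i j → ∣ position i - position j ∣ ≤ n
  ∣position-position∣≤n i j =
    ≤-trans (∣m-n∣≤m⊔n (position i) (position j)) (⊔-lub (position≤n i) (position≤n j))

  label-span : ∀ {i j} → i ≤ j → j < n → label j ∸ label i ≤ span n f
  label-span i≤j j<n = subst (_≤ span n f) (m≤n⇒∣m-n∣≡n∸m (label-mono i≤j j<n)) (∣f-f∣≤span f _ _)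

  radio-along-order : ∀ {i j} → i < j → j < n →
    k + 1 ≤ (label j ∸ label i) + cycDist n (vertex i) (vertex j)
  radio-along-order i<j j<n = subst (λ g → k + 1 ≤ g + cycDist n (vertex _) (vertex _))
    (m≤n⇒∣m-n∣≡n∸m (label-mono (<⇒≤ i<j) j<n))
    (radio (vertex _) (vertex _) (λ eq → <⇒≢ i<j (vertex-injective (<-trans i<j j<n) j<n eq)))

  two-steps≥ : ∀ a → 2 + a < n →
    label a + Ψ + ∣ cycDist n (vertex a) (vertex (2 + a)) - h ∣ ≤ label (2 + a)
  two-steps≥ a 2+a<n = begin
    label a + Ψ + ∣ d₃ - h ∣        ≡⟨ +-assoc (label a) Ψ _ ⟩
    label a + (Ψ + ∣ d₃ - h ∣)      ≤⟨ +-monoʳ-≤ (label a) Ψ+∣d₃-h∣≤X+Y ⟩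
    label a + (X + Y)               ≡⟨ cong (label a +_) X+Y≡ ⟩
    label a + (label (2 + a) ∸ label a) ≡⟨ m+[n∸m]≡n (≤-trans a≤b b≤c) ⟩
    label (2 + a)                   ∎
    where
    open ≤-Reasoning
    1+a<n = <-trans (n<1+n (1 + a)) 2+a<n
    a≤b = label-mono (n≤1+n a) 1+a<n
    b≤c = label-mono (n≤1+n (1 + a)) 2+a<n
    X = label (1 + a) ∸ label a
    Y = label (2 + a) ∸ label (1 + a)
    d₁ = cycDist n (vertex a) (vertex (1 + a))
    d₂ = cycDist n (vertex (1 + a)) (vertex (2 + a))
    d₃ = cycDist n (vertex a) (vertex (2 + a))
    X+Y≡ = [n∸m]+[o∸n]≡o∸m a≤b b≤c
    r₁ = radio-along-order (n<1+n a) 1+a<n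
    r₂ = radio-along-order (n<1+n (1 + a)) 2+a<n
    r₃ = subst (λ g → k + 1 ≤ g + d₃) (sym X+Y≡)
      (radio-along-order (<-trans (n<1+n a) (n<1+n (1 + a))) 2+a<n)
    perimeter≤k+1+h+h = subst (perimeter n (position a) (position (1 + a)) (position (2 + a)) ≤_)
      (sym k+1+h+h≡n) (perimeter≤ n (position≤n a) (position≤n (1 + a)) (position≤n (2 + a)))
    Ψ+∣d₃-h∣≤X+Y = two-gaps≥ {X = X} {Y} {d₁} {d₂} {d₃} (m∸n+n≡m h≤k+1) r₁ r₂ r₃ perimeter≤k+1+h+h

  signed-step-at : ∀ j → ∃[ δ ] ℤ.∣ δ ∣ ≡ ∣ cycDist n (vertex (2 * j)) (vertex (2 + 2 * j)) - h ∣
    × ℤ.+ p ℤ.∣ (ℤ.+ position (2 + 2 * j) ℤ.- ℤ.+ position (2 * j)) ℤ.- δ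
  signed-step-at j =
    signed-step (position (2 * j)) (position (2 + 2 * j)) p∣n p∣h (∣position-position∣≤n _ _)

  step : ℕ → ℤ
  step j = proj₁ (signed-step-at j)

  ∣step∣ : ∀ j → ℤ.∣ step j ∣ ≡ ∣ cycDist n (vertex (2 * j)) (vertex (2 + 2 * j)) - h ∣
  ∣step∣ j = proj₁ (proj₂ (signed-step-at j))

  p∣Δposition-step : ∀ j → ℤ.+ p ℤ.∣ (ℤ.+ position (2 + 2 * j) ℤ.- ℤ.+ position (2 * j)) ℤ.- step j
  p∣Δposition-step j = proj₂ (proj₂ (signed-step-at j))

  2[1+t]≡2+2t : ∀ t → 2 * suc t ≡ 2 + 2 * t
  2[1+t]≡2+2t t = *-suc 2 t

  label-growth : ∀ t → 2 * t < n → label 0 + Ψ * t + variation step t ≤ label (2 * t)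
  label-growth zero _ =
    ≤-reflexive (trans (+-identityʳ _) (trans (cong (label 0 +_) (*-zeroʳ Ψ)) (+-identityʳ _)))
  label-growth (suc t) 2+2t<n = begin
    label 0 + Ψ * suc t + (variation step t + ℤ.∣ step t ∣)
      ≡⟨ rearrange (label 0) Ψ t (variation step t) ℤ.∣ step t ∣ ⟩
    label 0 + Ψ * t + variation step t + Ψ + ℤ.∣ step t ∣
      ≤⟨ +-monoˡ-≤ ℤ.∣ step t ∣ (+-monoˡ-≤ Ψ (label-growth t 2t<n)) ⟩
    label (2 * t) + Ψ + ℤ.∣ step t ∣
      ≡⟨ cong (label (2 * t) + Ψ +_) (∣step∣ t) ⟩
    label (2 * t) + Ψ + ∣ cycDist n (vertex (2 * t)) (vertex (2 + 2 * t)) - h ∣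
      ≤⟨ two-steps≥ (2 * t) (subst (_< n) (2[1+t]≡2+2t t) 2+2t<n) ⟩
    label (2 + 2 * t)
      ≡⟨ cong label (2[1+t]≡2+2t t) ⟨
    label (2 * suc t) ∎
    where
    open ≤-Reasoning
    2t<n = <-trans (*-monoʳ-< 2 (n<1+n t)) 2+2t<n
    rearrange : ∀ a b c d e → a + b * suc c + (d + e) ≡ a + b * c + d + b + e
    rearrange = solve-∀

  p∣position-walk : ∀ j → ℤ.+ p ℤ.∣ ℤ.+ position (2 * j) ℤ.- walk (ℤ.+ position 0) step j
  p∣position-walk zero =
    subst (ℤ.+ p ℤ.∣_) (sym (ℤ.+-inverseʳ (ℤ.+ position 0))) (ℤ.∣ᵤ⇒∣ (p ∣0))
  p∣position-walk (suc j) = subst (ℤ.+ p ℤ.∣_)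
    (trans (telescope (ℤ.+ position (2 + 2 * j)) (ℤ.+ position (2 * j)) (step j) (walk (ℤ.+ position 0) step j))
           (cong (λ i → ℤ.+ position i ℤ.- walk (ℤ.+ position 0) step (suc j)) (sym (2[1+t]≡2+2t j))))
    (ℤ.∣m∣n⇒∣m+n (p∣Δposition-step j) (p∣position-walk j))
    where
    telescope : ∀ x y δ w → (x ℤ.- y ℤ.- δ) ℤ.+ (y ℤ.- w) ≡ x ℤ.- (w ℤ.+ δ)
    telescope = ℤ.solve-∀

  ⌈p/2⌉≤1+variation : ∀ t → 2 * t < n → n ≤ 2 * suc t → ceilHalf p ≤ suc (variation step t)
  ⌈p/2⌉≤1+variation t 2t<n n≤2[1+t] = ceilHalf≤ (*-cancelʳ-≤ p (2 * suc V) q (begin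
    p * q             ≡⟨ *-comm p q ⟩
    q * p             ≡⟨ n≡q*p ⟨
    n                 ≤⟨ n≤2[1+t] ⟩
    2 * suc t         ≤⟨ *-monoʳ-≤ 2 count ⟩
    2 * (suc V * q)   ≡⟨ *-assoc 2 (suc V) q ⟨
    2 * suc V * q     ∎))
    where
    open ≤-Reasoning
    open _∣_ p∣n renaming (quotient to q; equality to n≡q*p)
    instance
      q-nonZero : NonZero q
      q-nonZero = ≢-nonZero (λ q≡0 → ≢-nonZero⁻¹ n (trans n≡q*p (cong (_* p) q≡0)))
    V = variation step t
    2j<n : ∀ {j} → j ≤ t → 2 * j < n
    2j<n j≤t = ≤-<-trans (*-monoʳ-≤ 2 j≤t) 2t<n
    count : suc t ≤ suc V * q
    count = count≤window*blocks (λ j → position (2 * j)) (walk (ℤ.+ position 0) step)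
      (λ {j} _ → subst (position (2 * j) <_) n≡q*p (Fin.toℕ<n (vertex (2 * j))))
      (λ {i} {j} i≤t j≤t eq → *-cancelˡ-≡ i j 2 (vertex-injective (2j<n i≤t) (2j<n j≤t) (Fin.toℕ-injective eq)))
      (λ {j} _ → p∣position-walk j)
      (walk-spread≤variation (ℤ.+ position 0) step)

  span≥-odd : ∀ t → n ≡ suc (2 * t) → Ψ * t + ceilHalf p ∸ 1 ≤ span n f
  span≥-odd t n≡1+2t = begin
    Ψ * t + ceilHalf p ∸ 1     ≤⟨ m+n∸1≤m+o (Ψ * t) (⌈p/2⌉≤1+variation t 2t<n n≤2[1+t]) ⟩
    Ψ * t + variation step t   ≤⟨ m+n≤o⇒m≤o∸n _ growth ⟩
    label (2 * t) ∸ label 0    ≤⟨ label-span z≤n 2t<n ⟩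
    span n f                   ∎
    where
    open ≤-Reasoning
    2t<n = ≤-reflexive (sym n≡1+2t)
    growth : Ψ * t + variation step t + label 0 ≤ label (2 * t)
    growth = subst (_≤ label (2 * t)) (xy∙z≈yz∙x (label 0) (Ψ * t) (variation step t)) (label-growth t 2t<n)
    n≤2[1+t] = subst (_≤ 2 * suc t) (sym n≡1+2t) (subst (suc (2 * t) ≤_) (sym (2[1+t]≡2+2t t)) (n≤1+n _))

  -- The last vertex adds at least k + 1 − n/2, since no two vertices are more than n/2 apart.
  span≥-even : ∀ t → n ≡ 2 + 2 * t → Ψ * t + k + 1 ∸ suc t + ceilHalf p ∸ 1 ≤ span n f
  span≥-even t n≡2+2t = begin
    Ψ * t + k + 1 ∸ suc t + ceilHalf p ∸ 1
      ≤⟨ m+n∸1≤m+o (Ψ * t + k + 1 ∸ suc t) (⌈p/2⌉≤1+variation t 2t<n n≤2[1+t]) ⟩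
    Ψ * t + k + 1 ∸ suc t + V
      ≤⟨ +-monoˡ-≤ V (m≤n+o⇒m∸n≤o (Ψ * t + k + 1) (suc t) k+1-bound) ⟩
    Ψ * t + g + V                          ≤⟨ m+n≤o⇒m≤o∸n _ last-label ⟩
    label (1 + 2 * t) ∸ label 0            ≤⟨ label-span z≤n 1+2t<n ⟩
    span n f                               ∎
    where
    open ≤-Reasoning
    V = variation step t
    g = label (1 + 2 * t) ∸ label (2 * t)
    1+2t<n = ≤-reflexive (sym n≡2+2t)
    2t<n = <-trans (n<1+n _) 1+2t<n
    n≤2[1+t] = ≤-reflexive (trans n≡2+2t (sym (2[1+t]≡2+2t t)))
    d≤1+t : cycDist n (vertex (2 * t)) (vertex (1 + 2 * t)) ≤ suc t
    d≤1+t = *-cancelˡ-≤ 2 (subst (2 * cycDist n (vertex (2 * t)) (vertex (1 + 2 * t)) ≤_)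
      (trans n≡2+2t (sym (2[1+t]≡2+2t t))) (2*cycDistℕ≤n n (position (2 * t)) (position (1 + 2 * t))))
    k+1≤g+1+t : k + 1 ≤ g + suc t
    k+1≤g+1+t = ≤-trans (radio-along-order (n<1+n _) 1+2t<n) (+-monoʳ-≤ g d≤1+t)
    k+1-bound : Ψ * t + k + 1 ≤ suc t + (Ψ * t + g)
    k+1-bound = begin
      Ψ * t + k + 1         ≡⟨ +-assoc (Ψ * t) k 1 ⟩
      Ψ * t + (k + 1)       ≤⟨ +-monoʳ-≤ (Ψ * t) k+1≤g+1+t ⟩
      Ψ * t + (g + suc t)   ≡⟨ x∙yz≈zx∙y (Ψ * t) g (suc t) ⟩
      suc t + Ψ * t + g     ≡⟨ +-assoc (suc t) (Ψ * t) g ⟩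
      suc t + (Ψ * t + g)   ∎
    last-label : Ψ * t + g + V + label 0 ≤ label (1 + 2 * t)
    last-label = begin
      Ψ * t + g + V + label 0   ≡⟨ rearrange (Ψ * t) g V (label 0) ⟩
      label 0 + Ψ * t + V + g   ≤⟨ +-monoˡ-≤ g (label-growth t 2t<n) ⟩
      label (2 * t) + g         ≡⟨ m+[n∸m]≡n (label-mono (n≤1+n _) 1+2t<n) ⟩
      label (1 + 2 * t)         ∎
      where
      rearrange : ∀ a b c d → a + b + c + d ≡ d + a + c + b
      rearrange = solve-∀

  Φ≡Ψ : Φ n k ≡ Ψ
  Φ≡Ψ = Φ≡k+1∸h h≤k+1 k+1+h+h≡n

  LB+⌈p/2⌉∸1≤span : LB n k + ceilHalf p ∸ 1 ≤ span n f
  LB+⌈p/2⌉∸1≤span with odd∨even n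
  ... | inj₁ (t , n≡1+2t) = subst (λ b → b + ceilHalf p ∸ 1 ≤ span n f)
    (sym (trans (LB-odd n≡1+2t) (cong (_* t) Φ≡Ψ))) (span≥-odd t n≡1+2t)
  ... | inj₂ (zero , n≡0) = ⊥-elim (≢-nonZero⁻¹ n n≡0)
  ... | inj₂ (suc t , n≡2[1+t]) = subst (λ b → b + ceilHalf p ∸ 1 ≤ span n f)
    (sym (trans (LB-even n≡2[1+t]) (cong (λ φ → φ * t + k + 1 ∸ suc t) Φ≡Ψ)))
    (span≥-even t (trans n≡2[1+t] (2[1+t]≡2+2t t)))

proposition4p2 : (n k : ℕ) → 3 ≤ n → n / 2 ≤ k → k < n ∸ 3 → n % 2 ≢ k % 2 →
    RnLowerBound n k (LB n k + ceilHalf (pp n k) ∸ 1)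
proposition4p2 n@(suc _) k _ n/2≤k k<n∸3 n%2≢k%2 f radio =
  RadioLabelling.LB+⌈p/2⌉∸1≤span n-split (n/2≤k⇒h≤k+1 n/2≤k n-split)
    (gcd[m,n]∣m n h) (gcd[m,n]∣n n h) radio (sortedEnumeration f)
  where
  h = hh n k
  n-split = k+1+hh+hh≡n (<-≤-trans k<n∸3 (m∸n≤m n 3)) n%2≢k%2
  instance
    p-nonZero : NonZero (pp n k)
    p-nonZero = ≢-nonZero (gcd[m,n]≢0 n h (inj₁ (λ ())))
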